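{- Let $F$ be a field and $n\geq2$. The generalized cross-ratio defines a bijection from the set of special configurations of $2n$ points in $\mathbb P^{n-1}(F)$, considered up to the action of $PGL_n(F)$, onto $F^*=\mathbb P^1(F)\setminus\{0,\infty\}$.
   Context: A special configuration is an ordered $2n$-tuple of points $(l_0,\dots,l_{n-1},m_0,\dots,m_{n-1})$ in $\mathbb P^{n-1}(F)$ such that $l_0,\dots,l_{n-1}$ are the vertices of a simplex (i.e. span $\mathbb P^{n-1}$) and each $m_i$ lies on the line $l_il_{i+1}$ (indices mod $n$) and differs from $l_i$ and $l_{i+1}$. Generalized cross-ratio: let $L_i,M_i\subset F^n$ be the one-dimensional subspaces corresponding to $l_i,m_i$. Since $M_i\subset L_i\oplus L_{i+1}$ and $M_i\neq L_i,L_{i+1}$, there is a unique linear isomorphism $\phi_i:L_i\to L_{i+1}$ with $M_i=\{v+\phi_i(v):v\in L_i\}$. The composition $\phi_{n-1}\circ\dots\circ\phi_0:L_0\to L_0$ is multiplication by a scalar in $F^*$; this scalar is the generalized cross-ratio $r(l_0,\dots,l_{n-1},m_0,\dots,m_{n-1})$. -}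

module Defs where

open import Level using (Level; _⊔_) renaming (suc to lsuc)
open import Algebra.Bundles using (CommutativeRing)
open import Data.Nat as ℕ using (ℕ; zero; suc)
open import Data.Fin as Fin using (Fin; toℕ; fromℕ<)
open import Data.Fin.Properties using ()
import Data.Vec.Functional as VF
open import Data.Product using (Σ; ∃; _×_; _,_)
open import Relation.Nullary using (¬_; yes; no)
open import Data.Nat.Properties using ()

record Field c ℓ : Set (lsuc (c ⊔ ℓ)) where
  field
    commutativeRing : CommutativeRing c ℓ
  open CommutativeRing commutativeRing public
  field
    1≉0     : ¬ (1# ≈ 0#)
    inverse : ∀ x → ¬ (x ≈ 0#) → ∃ λ y → x * y ≈ 1#

next : ∀ {n} → Fin n → Fin n
next {suc k} i with ℕ.suc (toℕ i) ℕ.<? suc k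
... | yes p = fromℕ< p
... | no _  = Fin.zero

module _ {c ℓ} (F : Field c ℓ) (n : ℕ) where
  open Field F

  Vec : Set c
  Vec = Fin n → Carrier

  NonZeroVec : Vec → Set ℓ
  NonZeroVec v = ¬ (∀ j → v j ≈ 0#)

  _+ᵛ_ : Vec → Vec → Vec
  (u +ᵛ v) j = u j + v j

  _·ᵛ_ : Carrier → Vec → Vec
  (a ·ᵛ v) j = a * v j

  sumF : (Fin n → Carrier) → Carrier
  sumF f = VF.foldr _+_ 0# f

  prodF : (Fin n → Carrier) → Carrier
  prodF f = VF.foldr _*_ 1# f

  SamePoint : Vec → Vec → Set (c ⊔ ℓ)
  SamePoint u v = ∃ λ (t : Carrier) → ¬ (t ≈ 0#) × (∀ j → u j ≈ t * v j)

  Spans : (Fin n → Vec) → Set (c ⊔ ℓ)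
  Spans l = ∀ (v : Vec) → ∃ λ (a : Fin n → Carrier) → ∀ j → v j ≈ sumF (λ i → a i * l i j)

  OnLine : Vec → Vec → Vec → Set (c ⊔ ℓ)
  OnLine m p q = ∃ λ (a : Carrier) → ∃ λ (b : Carrier) → ∀ j → m j ≈ a * p j + b * q j

  record SpecialConfig : Set (c ⊔ ℓ) where
    field
      l m      : Fin n → Vec
      l-nz     : ∀ i → NonZeroVec (l i)
      m-nz     : ∀ i → NonZeroVec (m i)
      simplex  : Spans l
      on-line  : ∀ i → OnLine (m i) (l i) (l (next i))
      m≢lᵢ     : ∀ i → ¬ SamePoint (m i) (l i)
      m≢lᵢ₊₁   : ∀ i → ¬ SamePoint (m i) (l (next i))

  -- With representatives l_i of L_i, φ_i(l_i) = c_i l_{i+1} and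
  -- M_i = {v + φ_i v} is spanned by l_i + c_i l_{i+1}; the composite
  -- φ_{n-1} ∘ … ∘ φ_0 maps l_0 to (∏ c_i) l_0.
  IsCrossRatio : SpecialConfig → Carrier → Set (c ⊔ ℓ)
  IsCrossRatio C r =
    ∃ λ (cs : Fin n → Carrier) →
      (∀ i → SamePoint (m i) (l i +ᵛ (cs i ·ᵛ l (next i)))) × (r ≈ prodF cs)
    where open SpecialConfig C

  Matrix : Set c
  Matrix = Fin n → Fin n → Carrier

  apply : Matrix → Vec → Vec
  apply g v i = sumF (λ j → g i j * v j)

  Invertible : Matrix → Set (c ⊔ ℓ)
  Invertible g = ∃ λ (h : Matrix) → (∀ v j → apply h (apply g v) j ≈ v j)
                       × (∀ v j → apply g (apply h v) j ≈ v j)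

  PGLEquiv : SpecialConfig → SpecialConfig → Set (c ⊔ ℓ)
  PGLEquiv C D =
    ∃ λ (g : Matrix) → Invertible g
      × (∀ i → SamePoint (apply g (C.l i)) (D.l i))
      × (∀ i → SamePoint (apply g (C.m i)) (D.m i))
    where module C = SpecialConfig C
          module D = SpecialConfig D

{-# OPTIONS --safe #-}

-- Write φ_i as multiplication by a coefficient c_i with respect to chosen
-- representatives, so that the cross-ratio is ∏ c_i. Rescaling the
-- representatives of the l_i by units μ_i replaces c_i by c_i μ_{i+1} / μ_i,
-- which does not change the product; conversely, two coefficient families
-- with the same product differ by such a rescaling (a gauge). Hence a
-- projectivity between two configurations preserves the cross-ratio, and if
-- the cross-ratios agree, the change of basis sending each l_i to the
-- rescaled l′_i carries every m_i to m′_i as well. The linear algebra this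
-- needs is that n spanning vectors of Fⁿ are linearly independent; since
-- equality in F need not be decidable, it is proved with determinants.

module Submission where

open import Defs
open import Data.Nat using (ℕ; _≤_)
open import Data.Product using (∃; _×_)
open import Relation.Nullary using (¬_)

open import Level using (_⊔_)
open import Algebra.Bundles using (CommutativeMonoid; CommutativeRing)
open import Data.Bool using (true; false; if_then_else_)
open import Data.Empty using (⊥-elim)
open import Data.Fin as Fin using (Fin; zero; suc; toℕ; fromℕ; fromℕ<; inject₁; punchIn; punchOut; _≟_)
import Data.Fin.Properties as Fin
open import Data.Fin.Permutation.Components using (transpose)
open import Data.Nat as ℕ using (zero; suc; z≤n; s≤s; _<_; _<?_)
import Data.Nat.Properties as ℕ
open import Data.Product using (∃₂; _,_; proj₁; proj₂)
import Data.Product as Product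
open import Data.Sum as Sum using (_⊎_; inj₁; inj₂; [_,_]′)
open import Data.Vec.Functional using (Vector; _∷_; head; tail; updateAt; removeAt)
open import Data.Vec.Functional.Properties using (updateAt-updates; updateAt-minimal; updateAt-commutes; updateAt-id-local)
open import Function using (_∘_; const; id; _⇔_; mk⇔; Equivalence)
open import Relation.Binary.Definitions using (tri<; tri≈; tri>)
open import Relation.Binary.PropositionalEquality as ≡ using (_≡_; _≢_; cong; _≗_)
open import Relation.Nullary using (yes; no; does; Dec)
open import Relation.Nullary.Decidable using (dec-true; dec-false)

module _ {a} {A : Set a} {n : ℕ} where

  infixl 6 _[_]≔_

  _[_]≔_ : Vector A n → Fin n → A → Vector A n
  xs [ i ]≔ x = updateAt xs i (const x)

  swap : Vector A n → Fin n → Fin n → Vector A n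
  swap xs p q = xs ∘ transpose p q

transpose-matchˡ : ∀ {n} (p q : Fin n) → transpose p q p ≡ q
transpose-matchˡ p q rewrite dec-true (p ≟ p) ≡.refl = ≡.refl

transpose-matchʳ : ∀ {n} (p q : Fin n) → transpose p q q ≡ p
transpose-matchʳ p q with q ≟ p
... | yes q≡p = q≡p
... | no _ rewrite dec-true (q ≟ q) ≡.refl = ≡.refl

transpose-other : ∀ {n} {p q k : Fin n} → k ≢ p → k ≢ q → transpose p q k ≡ k
transpose-other {p = p} {q} {k} k≢p k≢q rewrite dec-false (k ≟ p) k≢p | dec-false (k ≟ q) k≢q = ≡.refl

missing⇒collision : ∀ {n} (τ : Fin n → Fin n) p → (∀ q → τ q ≢ p) → ∃₂ λ i j → i ≢ j × τ i ≡ τ j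
missing⇒collision {suc n} τ p missing
  with Fin.pigeonhole (ℕ.n<1+n n) (λ k → punchOut (missing k ∘ ≡.sym))
... | i , j , i<j , eq = i , j , Fin.<⇒≢ i<j , Fin.punchOut-injective (missing i ∘ ≡.sym) (missing j ∘ ≡.sym) eq

Adjacent : ∀ {n} → Fin n → Fin n → Set
Adjacent p q = toℕ q ≡ suc (toℕ p)

punchIn-adjacent : ∀ {n} {p q : Fin (suc n)} → Adjacent p q → ∀ k →
                   punchIn p k ≡ punchIn q k ⊎ (punchIn p k ≡ q × punchIn q k ≡ p)
punchIn-adjacent {p = zero}  {suc zero}    _   zero    = inj₂ (≡.refl , ≡.refl)
punchIn-adjacent {p = zero}  {suc zero}    _   (suc k) = inj₁ ≡.refl
punchIn-adjacent {p = suc p} {suc q}       adj zero    = inj₁ ≡.refl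
punchIn-adjacent {p = suc p} {suc q}       adj (suc k) =
  Sum.map (cong suc) (Product.map (cong suc) (cong suc)) (punchIn-adjacent (ℕ.suc-injective adj) k)

punchOut-adjacent : ∀ {n} {j p q : Fin (suc n)} → Adjacent p q → (j≢p : j ≢ p) (j≢q : j ≢ q) →
                    Adjacent (punchOut j≢p) (punchOut j≢q)
punchOut-adjacent {j = zero}  {zero}  _   j≢p _ = ⊥-elim (j≢p ≡.refl)
punchOut-adjacent {j = zero}  {suc p} {suc q} adj _ _ = ℕ.suc-injective adj
punchOut-adjacent {suc n} {suc zero} {zero} {suc zero} _ _ j≢q = ⊥-elim (j≢q ≡.refl)
punchOut-adjacent {suc (suc n)} {suc (suc j)} {zero} {suc zero} _ _ _ = ≡.refl
punchOut-adjacent {suc n} {suc j} {suc p} {suc q} adj j≢p j≢q =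
  cong suc (punchOut-adjacent (ℕ.suc-injective adj) (j≢p ∘ cong suc) (j≢q ∘ cong suc))

<⇒distance : ∀ {m n} → m < n → ∃ λ d → n ≡ suc (d ℕ.+ m)
<⇒distance {m} m<n with ℕ.m≤n⇒∃[o]m+o≡n m<n
... | d , 1+m+d≡n = d , ≡.trans (≡.sym 1+m+d≡n) (cong suc (ℕ.+-comm m d))

module _ {a} {A : Set a} {m : ℕ} where

  splice : ℕ → Vector A m → Vector A m → Vector A m
  splice k c b j = if does (toℕ j <? k) then c j else b j

  splice-at : ∀ (c b : Vector A m) {k j} → toℕ j ≡ k → splice k c b j ≡ b j
  splice-at c b {k} {j} j≡k rewrite dec-false (toℕ j <? k) (ℕ.<-irrefl j≡k) = ≡.refl

  splice-suc-at : ∀ (c b : Vector A m) {k j} → toℕ j ≡ k → splice (suc k) c b j ≡ c j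
  splice-suc-at c b {k} {j} j≡k rewrite dec-true (toℕ j <? suc k) (s≤s (ℕ.≤-reflexive j≡k)) = ≡.refl

  splice-suc-other : ∀ (c b : Vector A m) {k j} → toℕ j ≢ k → splice (suc k) c b j ≡ splice k c b j
  splice-suc-other c b {k} {j} j≢k with toℕ j <? k
  ... | yes j<k rewrite dec-true (toℕ j <? suc k) (ℕ.m<n⇒m<1+n j<k) | dec-true (toℕ j <? k) j<k = ≡.refl
  ... | no  j≮k rewrite dec-false (toℕ j <? suc k) ([ j≮k , j≢k ]′ ∘ ℕ.m<1+n⇒m<n∨m≡n)
                      | dec-false (toℕ j <? k) j≮k = ≡.refl

  splice-preserves : ∀ {p} (P : A → Set p) {c b : Vector A m} →
                     (∀ j → P (c j)) → (∀ j → P (b j)) → ∀ k j → P (splice k c b j)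
  splice-preserves P Pc Pb k j with does (toℕ j <? k)
  ... | true  = Pc j
  ... | false = Pb j

next-cases : ∀ {m} (i : Fin (suc m)) → toℕ (next i) ≡ suc (toℕ i) ⊎ (next i ≡ zero × toℕ i ≡ m)
next-cases {m} i with suc (toℕ i) ℕ.<? suc m
... | yes i+1<1+m = inj₁ (Fin.toℕ-fromℕ< i+1<1+m)
... | no  i+1≮1+m = inj₂ (≡.refl , ℕ.≤-antisym (ℕ.≤-pred (Fin.toℕ<n i)) (ℕ.≮⇒≥ (i+1≮1+m ∘ s≤s)))

next-inject₁ : ∀ {m} (j : Fin m) → next (inject₁ j) ≡ suc j
next-inject₁ {m} j with next-cases (inject₁ j)
... | inj₁ toℕ-next = Fin.toℕ-injective (≡.trans toℕ-next (cong suc (Fin.toℕ-inject₁ j)))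
... | inj₂ (_ , j≡m) = ⊥-elim (ℕ.<-irrefl (≡.trans (≡.sym (Fin.toℕ-inject₁ j)) j≡m) (Fin.toℕ<n j))

next-fromℕ : ∀ m → next (fromℕ m) ≡ zero
next-fromℕ m with next-cases (fromℕ m)
... | inj₁ toℕ-next = ⊥-elim (ℕ.<-irrefl (≡.trans toℕ-next (cong suc (Fin.toℕ-fromℕ m))) (Fin.toℕ<n (next (fromℕ m))))
... | inj₂ (next≡0 , _) = next≡0

next≢id : ∀ {m} (i : Fin (suc (suc m))) → next i ≢ i
next≢id i next≡i with next-cases i
... | inj₁ toℕ-next = ℕ.m≢1+n+m (toℕ i) {0} (≡.trans (cong toℕ (≡.sym next≡i)) toℕ-next)
... | inj₂ (next≡0 , i≡1+m) with ≡.trans (≡.sym next≡i) next≡0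
...   | ≡.refl with i≡1+m
...     | ()

module CyclicProducts {a ℓ} (M : CommutativeMonoid a ℓ) where

  open CommutativeMonoid M
  open import Algebra.Properties.CommutativeMonoid.Sum M
    using (sum-cong-≋; sum-init-last; sum-remove; ∑-distrib-+) renaming (sum to ∏)
  open import Algebra.Properties.CommutativeSemigroup commutativeSemigroup using (x∙yz≈y∙xz)
  open import Relation.Binary.Reasoning.Setoid setoid

  ∏-next : ∀ {m} (f : Vector Carrier (suc m)) → ∏ (f ∘ next) ≈ ∏ f
  ∏-next {m} f = begin
    ∏ (f ∘ next)                                       ≈⟨ sum-init-last (f ∘ next) ⟩
    ∏ (λ j → f (next (inject₁ j))) ∙ f (next (fromℕ m)) ≈⟨ ∙-cong (sum-cong-≋ (λ j → reflexive (cong f (next-inject₁ j))))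
                                                                  (reflexive (cong f (next-fromℕ m))) ⟩
    ∏ (f ∘ suc) ∙ f zero                               ≈⟨ comm _ _ ⟩
    ∏ f                                                ∎

  ∏-telescope : ∀ {m} (b c μ : Vector Carrier (suc m)) → (∀ i → b i ∙ μ (next i) ≈ μ i ∙ c i) →
                ∏ μ ∙ ∏ b ≈ ∏ μ ∙ ∏ c
  ∏-telescope b c μ twisted = begin
    ∏ μ ∙ ∏ b                        ≈⟨ comm _ _ ⟩
    ∏ b ∙ ∏ μ                        ≈⟨ ∙-congˡ (∏-next μ) ⟨
    ∏ b ∙ ∏ (μ ∘ next)               ≈⟨ ∑-distrib-+ b (μ ∘ next) ⟨
    ∏ (λ i → b i ∙ μ (next i))       ≈⟨ sum-cong-≋ twisted ⟩
    ∏ (λ i → μ i ∙ c i)              ≈⟨ ∑-distrib-+ μ c ⟩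
    ∏ μ ∙ ∏ c                        ∎

  splice-step : ∀ {m} (c b : Vector Carrier m) {k} j → toℕ j ≡ k →
                b j ∙ ∏ (splice (suc k) c b) ≈ c j ∙ ∏ (splice k c b)
  splice-step {suc m} c b {k} j j≡k = begin
    b j ∙ ∏ (splice (suc k) c b)             ≈⟨ ∙-congˡ (sum-remove {i = j} (splice (suc k) c b)) ⟩
    b j ∙ (splice (suc k) c b j ∙ ∏ rest)    ≈⟨ ∙-congˡ (∙-congʳ (reflexive (splice-suc-at c b j≡k))) ⟩
    b j ∙ (c j ∙ ∏ rest)                     ≈⟨ x∙yz≈y∙xz (b j) (c j) (∏ rest) ⟩
    c j ∙ (b j ∙ ∏ rest)
      ≈⟨ ∙-congˡ (∙-cong (reflexive (≡.sym (splice-at c b j≡k))) (sum-cong-≋ same-elsewhere)) ⟩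
    c j ∙ (splice k c b j ∙ ∏ (removeAt (splice k c b) j)) ≈⟨ ∙-congˡ (sum-remove {i = j} (splice k c b)) ⟨
    c j ∙ ∏ (splice k c b)                   ∎
    where
    rest = removeAt (splice (suc k) c b) j
    same-elsewhere : ∀ l → rest l ≈ removeAt (splice k c b) j l
    same-elsewhere l = reflexive (splice-suc-other c b
      (λ l′≡k → Fin.punchInᵢ≢i j l (Fin.toℕ-injective (≡.trans l′≡k (≡.sym j≡k)))))

  gauge : ∀ {m} → Vector Carrier m → Vector Carrier m → Vector Carrier m
  gauge b c i = ∏ (splice (toℕ i) c b)

  -- Passing from i to next i trades the factor b i for c i; at the
  -- wrap-around this needs ∏ b ≈ ∏ c.
  gauge-twists : ∀ {m} (b c : Vector Carrier (suc m)) → ∏ b ≈ ∏ c → ∀ i → b i ∙ gauge b c (next i) ≈ gauge b c i ∙ c i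
  gauge-twists {m} b c ∏b≈∏c i = trans (∙-congˡ gauge-next) (trans (splice-step c b i ≡.refl) (comm _ _))
    where
    gauge-next : gauge b c (next i) ≈ ∏ (splice (suc (toℕ i)) c b)
    gauge-next with next-cases i
    ... | inj₁ toℕ-next       = reflexive (cong (λ k → ∏ (splice k c b)) toℕ-next)
    ... | inj₂ (next≡0 , i≡m) = begin
      gauge b c (next i)             ≡⟨ cong (gauge b c) next≡0 ⟩
      ∏ b                            ≈⟨ ∏b≈∏c ⟩
      ∏ c                            ≈⟨ sum-cong-≋ (λ j → reflexive (≡.sym (below j))) ⟩
      ∏ (splice (suc (toℕ i)) c b)   ∎
      where
      below : ∀ j → splice (suc (toℕ i)) c b j ≡ c j
      below j rewrite dec-true (toℕ j <? suc (toℕ i)) (≡.subst (λ k → toℕ j < suc k) (≡.sym i≡m) (Fin.toℕ<n j)) = ≡.refl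

module LinearAlgebra {c ℓ} (R : CommutativeRing c ℓ) where

  open CommutativeRing R hiding (zero)
  open import Algebra.Properties.Ring ring
    using (-0#≈0#; -‿+-comm; -‿distribˡ-*; -‿involutive; -‿injective; x[y-z]≈xy-xz; [y-z]x≈yx-zx;
           +-inverseʳ-unique; x∙y⁻¹≈ε⇒x≈y; x≈y⇒x∙y⁻¹≈ε)
  open import Algebra.Properties.CommutativeSemigroup +-commutativeSemigroup using (interchange)
  open import Algebra.Properties.CommutativeSemigroup *-commutativeSemigroup using (x∙yz≈y∙xz; xy∙z≈xz∙y)
  open import Algebra.Properties.Semiring.Sum semiring
    using (sum; sum-cong-≋; sum-remove; sum-replicate-zero; ∑-comm; ∑-distrib-+; *-distribˡ-sum; *-distribʳ-sum)
  open import Algebra.Properties.Semiring.Divisibility semiring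
    using (_∣_; _,_; _∣0; ∣ʳ-reflexive; ∣ʳ-respʳ-≈; x∣ʳy⇒x∣ʳzy)
  open import Algebra.Solver.Ring.NaturalCoefficients.Default commutativeSemiring using (solve; _:=_; _:+_; _:*_)
  open import Data.Vec.Functional.Relation.Binary.Equality.Setoid setoid using (_≋_; ≋-refl; ≋-sym; ≋-trans; ≋-reflexive)
  open import Relation.Binary.Reasoning.Setoid setoid

  -- det, linComb and Spanning read u : Mat n as the family of its columns
  -- u j, whereas _·_ reads g : Mat n by rows.
  Mat : ℕ → Set c
  Mat n = Vector (Vector Carrier n) n

  infix 4 _≋ᴹ_

  _≋ᴹ_ : ∀ {n} → Mat n → Mat n → Set ℓ
  u ≋ᴹ w = ∀ i → u i ≋ w i

  ≗⇒≋ᴹ : ∀ {n} {u w : Mat n} → u ≗ w → u ≋ᴹ w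
  ≗⇒≋ᴹ u≗w i = ≋-reflexive (u≗w i)

  δ : ∀ {n} → Mat n
  δ zero    zero    = 1#
  δ zero    (suc j) = 0#
  δ (suc i) zero    = 0#
  δ (suc i) (suc j) = δ i j

  δ-diagonal : ∀ {n} (i : Fin n) → δ i i ≡ 1#
  δ-diagonal zero    = ≡.refl
  δ-diagonal (suc i) = δ-diagonal i

  δ-sym : ∀ {n} (i j : Fin n) → δ i j ≡ δ j i
  δ-sym zero    zero    = ≡.refl
  δ-sym zero    (suc j) = ≡.refl
  δ-sym (suc i) zero    = ≡.refl
  δ-sym (suc i) (suc j) = δ-sym i j

  δ-off-diagonal : ∀ {n} {i j : Fin n} → i ≢ j → δ i j ≡ 0#
  δ-off-diagonal {i = zero}  {zero}  i≢j = ⊥-elim (i≢j ≡.refl)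
  δ-off-diagonal {i = zero}  {suc j} _   = ≡.refl
  δ-off-diagonal {i = suc i} {zero}  _   = ≡.refl
  δ-off-diagonal {i = suc i} {suc j} i≢j = δ-off-diagonal (i≢j ∘ cong suc)

  sum-single : ∀ {n} (f : Vector Carrier n) k → (∀ j → j ≢ k → f j ≈ 0#) → sum f ≈ f k
  sum-single {suc n} f k vanishes = begin
    sum f                     ≈⟨ sum-remove f ⟩
    f k + sum (removeAt f k)  ≈⟨ +-congˡ (sum-cong-≋ (λ j → vanishes (punchIn k j) (Fin.punchInᵢ≢i k j))) ⟩
    f k + sum {n} (const 0#)  ≈⟨ +-congˡ (sum-replicate-zero n) ⟩
    f k + 0#                  ≈⟨ +-identityʳ (f k) ⟩
    f k                       ∎

  ∑-δ : ∀ {n} (i : Fin n) (f : Vector Carrier n) → sum (λ k → δ i k * f k) ≈ f i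
  ∑-δ i f = begin
    sum (λ k → δ i k * f k) ≈⟨ sum-single _ i (λ k k≢i → trans (*-congʳ (reflexive (δ-off-diagonal (k≢i ∘ ≡.sym)))) (zeroˡ (f k))) ⟩
    δ i i * f i             ≈⟨ *-congʳ (reflexive (δ-diagonal i)) ⟩
    1# * f i                ≈⟨ *-identityˡ (f i) ⟩
    f i                     ∎

  linComb : ∀ {m n} → Vector Carrier m → Vector (Vector Carrier n) m → Vector Carrier n
  linComb a v i = sum (λ j → a j * v j i)

  Spanning : ∀ {m n} → Vector (Vector Carrier n) m → Set (c ⊔ ℓ)
  Spanning v = ∀ x → ∃ λ a → x ≋ linComb a v

  Independent : ∀ {m n} → Vector (Vector Carrier n) m → Set (c ⊔ ℓ)
  Independent v = ∀ a → (∀ i → linComb a v i ≈ 0#) → ∀ j → a j ≈ 0#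

  -- Determinants, by Laplace expansion along the first row

  ∣-+ : ∀ {x y z} → x ∣ y → x ∣ z → x ∣ y + z
  ∣-+ {x} (a , ax≈y) (b , bx≈z) = a + b , trans (distribʳ x a b) (+-cong ax≈y bx≈z)

  ∣-sum : ∀ {n x} {f : Vector Carrier n} → (∀ j → x ∣ f j) → x ∣ sum f
  ∣-sum {zero}  {x} _   = x ∣0
  ∣-sum {suc n} x∣f = ∣-+ (x∣f zero) (∣-sum (x∣f ∘ suc))

  ∣-‿ : ∀ {x y} → x ∣ y → x ∣ - y
  ∣-‿ {x} (a , ax≈y) = - a , trans (sym (-‿distribˡ-* a x)) (-‿cong ax≈y)

  altSum : ∀ {n} → Vector Carrier n → Carrier
  altSum {zero}  f = 0#
  altSum {suc n} f = f zero - altSum (f ∘ suc)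

  altSum-cong : ∀ {n} {f g : Vector Carrier n} → f ≋ g → altSum f ≈ altSum g
  altSum-cong {zero}  f≋g = refl
  altSum-cong {suc n} f≋g = +-cong (f≋g zero) (-‿cong (altSum-cong (f≋g ∘ suc)))

  altSum-zero : ∀ {n} {f : Vector Carrier n} → (∀ j → f j ≈ 0#) → altSum f ≈ 0#
  altSum-zero {zero}  _ = refl
  altSum-zero {suc n} f≈0 = begin
    _ - _    ≈⟨ +-cong (f≈0 zero) (-‿cong (altSum-zero (f≈0 ∘ suc))) ⟩
    0# - 0#  ≈⟨ -‿inverseʳ 0# ⟩
    0#       ∎

  altSum-linear : ∀ {n} a b (f g : Vector Carrier n) →
                  altSum (λ j → a * f j + b * g j) ≈ a * altSum f + b * altSum g
  altSum-linear {zero} a b f g = begin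
    0#                ≈⟨ +-identityʳ 0# ⟨
    0# + 0#           ≈⟨ +-cong (zeroʳ a) (zeroʳ b) ⟨
    a * 0# + b * 0#   ∎
  altSum-linear {suc n} a b f g = begin
    (a * f zero + b * g zero) - altSum (λ j → a * f (suc j) + b * g (suc j))
      ≈⟨ +-congˡ (-‿cong (altSum-linear a b (f ∘ suc) (g ∘ suc))) ⟩
    (a * f zero + b * g zero) - (a * F + b * G)
      ≈⟨ +-congˡ (-‿+-comm (a * F) (b * G)) ⟨
    (a * f zero + b * g zero) + (- (a * F) + - (b * G))
      ≈⟨ interchange _ _ _ _ ⟩
    (a * f zero - a * F) + (b * g zero - b * G)
      ≈⟨ +-cong (x[y-z]≈xy-xz a _ _) (x[y-z]≈xy-xz b _ _) ⟨
    a * (f zero - F) + b * (g zero - G) ∎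
    where
    F = altSum (f ∘ suc)
    G = altSum (g ∘ suc)

  altSum-adjacent : ∀ {n} (f : Vector Carrier n) {p q} → Adjacent p q →
                    (∀ j → j ≢ p → j ≢ q → f j ≈ 0#) → f p ≈ f q → altSum f ≈ 0#
  altSum-adjacent f {zero} {suc zero} _ vanishes fp≈fq = begin
    f zero - (f (suc zero) - altSum (λ j → f (suc (suc j))))
      ≈⟨ +-congˡ (-‿cong (+-congˡ (-‿cong (altSum-zero (λ j → vanishes (suc (suc j)) (λ ()) (λ ())))))) ⟩
    f zero - (f (suc zero) - 0#) ≈⟨ +-congˡ (-‿cong (trans (+-congˡ -0#≈0#) (+-identityʳ _))) ⟩
    f zero - f (suc zero)        ≈⟨ +-congʳ fp≈fq ⟩
    f (suc zero) - f (suc zero)  ≈⟨ -‿inverseʳ _ ⟩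
    0#                           ∎
  altSum-adjacent f {suc p} {suc q} adj vanishes fp≈fq = begin
    f zero - altSum (f ∘ suc)
      ≈⟨ +-cong (vanishes zero (λ ()) (λ ()))
                (-‿cong (altSum-adjacent (f ∘ suc) (ℕ.suc-injective adj)
                          (λ j j≢p j≢q → vanishes (suc j) (j≢p ∘ Fin.suc-injective) (j≢q ∘ Fin.suc-injective)) fp≈fq)) ⟩
    0# - 0# ≈⟨ -‿inverseʳ 0# ⟩
    0#      ∎

  minor : ∀ {n} → Fin (suc n) → Mat (suc n) → Mat n
  minor j u k = tail (u (punchIn j k))

  det : ∀ {n} → Mat n → Carrier
  det {zero}  u = 1#
  det {suc n} u = altSum (λ j → head (u j) * det (minor j u))

  det-cong : ∀ {n} {u w : Mat n} → u ≋ᴹ w → det u ≈ det w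
  det-cong {zero}  u≋w = refl
  det-cong {suc n} u≋w = altSum-cong (λ j → *-cong (u≋w j zero) (det-cong (λ k → u≋w (punchIn j k) ∘ suc)))

  minor-[]≔-same : ∀ {n} (u : Mat (suc n)) k x → minor k (u [ k ]≔ x) ≗ minor k u
  minor-[]≔-same u k x c = cong tail (updateAt-minimal (punchIn k c) k u (Fin.punchInᵢ≢i k c))

  minor-[]≔-other : ∀ {n} (u : Mat (suc n)) {j k} (j≢k : j ≢ k) x →
                         minor j (u [ k ]≔ x) ≗ minor j u [ punchOut j≢k ]≔ tail x
  minor-[]≔-other u {j} {k} j≢k x c with c ≟ punchOut j≢k
  ... | yes ≡.refl = ≡.trans (cong (λ i → tail ((u [ k ]≔ x) i)) (Fin.punchIn-punchOut j≢k))
                           (≡.trans (cong tail (updateAt-updates k u))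
                                    (≡.sym (updateAt-updates (punchOut j≢k) (minor j u))))
  ... | no c≢k′ = ≡.trans (cong tail (updateAt-minimal (punchIn j c) k u punchIn≢k))
                          (≡.sym (updateAt-minimal c (punchOut j≢k) (minor j u) c≢k′))
    where
    punchIn≢k : punchIn j c ≢ k
    punchIn≢k eq = c≢k′ (≡.trans (≡.sym (Fin.punchOut-punchIn j)) (Fin.punchOut-cong′ j eq))

  det-linear : ∀ {n} (u : Mat n) k a b x y →
               det (u [ k ]≔ (λ i → a * x i + b * y i)) ≈ a * det (u [ k ]≔ x) + b * det (u [ k ]≔ y)
  det-linear {suc n} u k a b x y = begin
    altSum (term (λ i → a * x i + b * y i)) ≈⟨ altSum-cong (λ j → term-linear j (j ≟ k)) ⟩
    altSum (λ j → a * term x j + b * term y j) ≈⟨ altSum-linear a b (term x) (term y) ⟩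
    a * det (u [ k ]≔ x) + b * det (u [ k ]≔ y) ∎
    where
    term : Vector Carrier (suc n) → Fin (suc n) → Carrier
    term z j = head ((u [ k ]≔ z) j) * det (minor j (u [ k ]≔ z))

    term-at : ∀ z → term z k ≈ head z * det (minor k u)
    term-at z = *-cong (reflexive (cong head (updateAt-updates k u))) (det-cong (≗⇒≋ᴹ (minor-[]≔-same u k z)))

    term-off : ∀ {j} (j≢k : j ≢ k) z → term z j ≈ head (u j) * det (minor j u [ punchOut j≢k ]≔ tail z)
    term-off {j} j≢k z = *-cong (reflexive (cong head (updateAt-minimal j k u j≢k)))
                                (det-cong (≗⇒≋ᴹ (minor-[]≔-other u j≢k z)))

    term-linear : ∀ j → Dec (j ≡ k) → term (λ i → a * x i + b * y i) j ≈ a * term x j + b * term y j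
    term-linear j (yes ≡.refl) = begin
      term _ j                                              ≈⟨ term-at _ ⟩
      (a * head x + b * head y) * D                         ≈⟨ distributes a b (head x) (head y) D ⟩
      a * (head x * D) + b * (head y * D)                   ≈⟨ +-cong (*-congˡ (term-at x)) (*-congˡ (term-at y)) ⟨
      a * term x j + b * term y j                           ∎
      where
      D = det (minor k u)
      distributes : ∀ a b x y d → (a * x + b * y) * d ≈ a * (x * d) + b * (y * d)
      distributes = solve 5 (λ a b x y d → (a :* x :+ b :* y) :* d := a :* (x :* d) :+ b :* (y :* d)) refl
    term-linear j (no j≢k) = begin
      term _ j                                              ≈⟨ term-off j≢k _ ⟩
      h * det (u′ [ k′ ]≔ (λ i → a * x (suc i) + b * y (suc i)))
        ≈⟨ *-congˡ (det-linear u′ k′ a b (tail x) (tail y)) ⟩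
      h * (a * det (u′ [ k′ ]≔ tail x) + b * det (u′ [ k′ ]≔ tail y))
        ≈⟨ distributes h a b _ _ ⟩
      a * (h * det (u′ [ k′ ]≔ tail x)) + b * (h * det (u′ [ k′ ]≔ tail y))
        ≈⟨ +-cong (*-congˡ (term-off j≢k x)) (*-congˡ (term-off j≢k y)) ⟨
      a * term x j + b * term y j                           ∎
      where
      h = head (u j)
      u′ = minor j u
      k′ = punchOut j≢k
      distributes : ∀ h a b x y → h * (a * x + b * y) ≈ a * (h * x) + b * (h * y)
      distributes = solve 5 (λ h a b x y → h :* (a :* x :+ b :* y) := a :* (h :* x) :+ b :* (h :* y)) refl

  ≋ᴹ-[]≔ : ∀ {n} {u w : Mat n} {k x} → u k ≋ x → (∀ j → j ≢ k → u j ≋ w j) → u ≋ᴹ w [ k ]≔ x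
  ≋ᴹ-[]≔ {w = w} {k} at-k elsewhere j with j ≟ k
  ... | yes ≡.refl = ≋-trans at-k (≋-reflexive (≡.sym (updateAt-updates k w)))
  ... | no j≢k     = ≋-trans (elsewhere j j≢k) (≋-reflexive (≡.sym (updateAt-minimal j k w j≢k)))

  det-[]≔-cong : ∀ {n} (u : Mat n) k {x y} → x ≋ y → det (u [ k ]≔ x) ≈ det (u [ k ]≔ y)
  det-[]≔-cong u k x≋y = det-cong (≋ᴹ-[]≔ (≋-trans (≋-reflexive (updateAt-updates k u)) x≋y)
                                                (λ j j≢k → ≋-reflexive (updateAt-minimal j k u j≢k)))

  det-[]≔-zero : ∀ {n} (u : Mat n) k → det (u [ k ]≔ (λ _ → 0#)) ≈ 0#
  det-[]≔-zero u k = begin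
    det (u [ k ]≔ (λ _ → 0#))                       ≈⟨ det-[]≔-cong u k (λ _ → 0*0+0*0≈0) ⟨
    det (u [ k ]≔ (λ _ → 0# * 0# + 0# * 0#))        ≈⟨ det-linear u k 0# 0# _ _ ⟩
    0# * det (u [ k ]≔ _) + 0# * det (u [ k ]≔ _)   ≈⟨ +-cong (zeroˡ _) (zeroˡ _) ⟩
    0# + 0#                                         ≈⟨ +-identityʳ 0# ⟩
    0#                                              ∎
    where
    0*0+0*0≈0 : 0# * 0# + 0# * 0# ≈ 0#
    0*0+0*0≈0 = trans (+-cong (zeroˡ 0#) (zeroˡ 0#)) (+-identityʳ 0#)

  det-[]≔-+ : ∀ {n} (u : Mat n) k x y →
                   det (u [ k ]≔ (λ i → x i + y i)) ≈ det (u [ k ]≔ x) + det (u [ k ]≔ y)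
  det-[]≔-+ u k x y = begin
    det (u [ k ]≔ (λ i → x i + y i))                  ≈⟨ det-[]≔-cong u k (λ i → +-cong (*-identityˡ (x i)) (*-identityˡ (y i))) ⟨
    det (u [ k ]≔ (λ i → 1# * x i + 1# * y i))        ≈⟨ det-linear u k 1# 1# x y ⟩
    1# * det (u [ k ]≔ x) + 1# * det (u [ k ]≔ y)     ≈⟨ +-cong (*-identityˡ _) (*-identityˡ _) ⟩
    det (u [ k ]≔ x) + det (u [ k ]≔ y)               ∎

  det-[]≔-linComb : ∀ {m n} (u : Mat n) k (a : Vector Carrier m) (v : Vector (Vector Carrier n) m) →
                         det (u [ k ]≔ linComb a v) ≈ sum (λ j → a j * det (u [ k ]≔ v j))
  det-[]≔-linComb {zero}  u k a v = det-[]≔-zero u k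
  det-[]≔-linComb {suc m} u k a v = begin
    det (u [ k ]≔ linComb a v)                               ≈⟨ det-[]≔-cong u k (λ i → +-congˡ (*-identityˡ _)) ⟨
    det (u [ k ]≔ (λ i → a zero * v zero i + 1# * rest i))   ≈⟨ det-linear u k (a zero) 1# (v zero) rest ⟩
    a zero * det (u [ k ]≔ v zero) + 1# * det (u [ k ]≔ rest)
      ≈⟨ +-congˡ (trans (*-identityˡ _) (det-[]≔-linComb u k (a ∘ suc) (v ∘ suc))) ⟩
    sum (λ j → a j * det (u [ k ]≔ v j))                     ∎
    where
    rest = linComb (a ∘ suc) (v ∘ suc)

  det-adjacent : ∀ {n} (u : Mat n) {p q} → Adjacent p q → u p ≋ u q → det u ≈ 0#
  det-adjacent {suc n} u {p} {q} adj up≋uq =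
    altSum-adjacent _ adj vanishing (*-cong (up≋uq zero) (det-cong minors-equal))
    where
    column : ∀ {i j} → i ≡ j → tail (u i) ≋ tail (u j)
    column i≡j = ≋-reflexive (cong (tail ∘ u) i≡j)

    vanishing : ∀ j → j ≢ p → j ≢ q → head (u j) * det (minor j u) ≈ 0#
    vanishing j j≢p j≢q = trans (*-congˡ (det-adjacent (minor j u) (punchOut-adjacent adj j≢p j≢q) columns-equal)) (zeroʳ _)
      where
      columns-equal : minor j u (punchOut j≢p) ≋ minor j u (punchOut j≢q)
      columns-equal = ≋-trans (column (Fin.punchIn-punchOut j≢p))
                        (≋-trans (up≋uq ∘ suc) (column (≡.sym (Fin.punchIn-punchOut j≢q))))

    minors-equal : minor p u ≋ᴹ minor q u
    minors-equal k with punchIn-adjacent adj k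
    ... | inj₁ eq          = column eq
    ... | inj₂ (eq₁ , eq₂) = ≋-trans (column eq₁) (≋-trans (≋-sym (up≋uq ∘ suc)) (column (≡.sym eq₂)))

  -- 0 ≈ det (N s s) for s = u p + u q; expanding both slots by linearity
  -- leaves det u + det (swap u p q).
  det-swap-if-alternating : ∀ {n} (u : Mat n) {p q} → p ≢ q → (∀ w → w p ≋ w q → det w ≈ 0#) →
                            det (swap u p q) ≈ - det u
  det-swap-if-alternating u {p} {q} p≢q alternating = +-inverseʳ-unique (det u) (det (swap u p q)) (begin
    det u + det (swap u p q)                                    ≈⟨ +-cong (det-cong u≋N) (det-cong swap≋N) ⟩
    det (N x y) + det (N y x)                                   ≈⟨ +-cong (+-identityˡ _) (+-identityʳ _) ⟨
    (0# + det (N x y)) + (det (N y x) + 0#)                     ≈⟨ +-cong (+-congʳ (diagonal x)) (+-congˡ (diagonal y)) ⟨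
    (det (N x x) + det (N x y)) + (det (N y x) + det (N y y))   ≈⟨ +-cong (additiveʳ x x y) (additiveʳ y x y) ⟨
    det (N x s) + det (N y s)                                   ≈⟨ additiveˡ x y s ⟨
    det (N s s)                                                 ≈⟨ diagonal s ⟩
    0#                                                          ∎)
    where
    x = u p
    y = u q
    s = λ i → x i + y i

    N : Vector Carrier _ → Vector Carrier _ → Mat _
    N a b = u [ p ]≔ a [ q ]≔ b

    N-p : ∀ a b → N a b p ≡ a
    N-p a b = ≡.trans (updateAt-minimal p q _ p≢q) (updateAt-updates p u)

    N-q : ∀ a b → N a b q ≡ b
    N-q a b = updateAt-updates q _

    ≋N : ∀ {w a b} → w p ≋ a → w q ≋ b → (∀ j → j ≢ p → j ≢ q → w j ≋ u j) → w ≋ᴹ N a b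
    ≋N {w} {a} {b} at-p at-q elsewhere j with j ≟ q | j ≟ p
    ... | yes ≡.refl | _          = ≋-trans at-q (≋-reflexive (≡.sym (N-q a b)))
    ... | no _       | yes ≡.refl = ≋-trans at-p (≋-reflexive (≡.sym (N-p a b)))
    ... | no j≢q     | no j≢p     = ≋-trans (elsewhere j j≢p j≢q)
      (≋-reflexive (≡.sym (≡.trans (updateAt-minimal j q _ j≢q) (updateAt-minimal j p u j≢p))))

    u≋N : u ≋ᴹ N x y
    u≋N = ≋N ≋-refl ≋-refl (λ _ _ _ → ≋-refl)

    swap≋N : swap u p q ≋ᴹ N y x
    swap≋N = ≋N (≋-reflexive (cong u (transpose-matchˡ p q))) (≋-reflexive (cong u (transpose-matchʳ p q)))
                (λ j j≢p j≢q → ≋-reflexive (cong u (transpose-other j≢p j≢q)))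

    diagonal : ∀ a → det (N a a) ≈ 0#
    diagonal a = alternating (N a a) (≋-reflexive (≡.trans (N-p a a) (≡.sym (N-q a a))))

    additiveʳ : ∀ a b b′ → det (N a (λ i → b i + b′ i)) ≈ det (N a b) + det (N a b′)
    additiveʳ a = det-[]≔-+ (u [ p ]≔ a) q

    additiveˡ : ∀ a a′ b → det (N (λ i → a i + a′ i) b) ≈ det (N a b) + det (N a′ b)
    additiveˡ a a′ b = begin
      det (N (λ i → a i + a′ i) b)                         ≈⟨ det-cong (commute _) ⟩
      det (u [ q ]≔ b [ p ]≔ (λ i → a i + a′ i))           ≈⟨ det-[]≔-+ (u [ q ]≔ b) p a a′ ⟩
      det (u [ q ]≔ b [ p ]≔ a) + det (u [ q ]≔ b [ p ]≔ a′) ≈⟨ +-cong (det-cong (commute a)) (det-cong (commute a′)) ⟨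
      det (N a b) + det (N a′ b)                           ∎
      where
      commute : ∀ a → N a b ≋ᴹ u [ q ]≔ b [ p ]≔ a
      commute a = ≗⇒≋ᴹ (updateAt-commutes q p (p≢q ∘ ≡.sym) u)

  det-equal-at-distance : ∀ {n} d (u : Mat n) {p q} → toℕ q ≡ suc (d ℕ.+ toℕ p) → u p ≋ u q → det u ≈ 0#
  det-equal-at-distance zero    u distance = det-adjacent u distance
  det-equal-at-distance {suc n} (suc d) u {p} {suc q₀} distance up≋uq = -‿injective (begin
    - det u                 ≈⟨ det-swap-if-alternating u q′≢q (λ w → det-adjacent w q′-q-adjacent) ⟨
    det (swap u q′ (suc q₀)) ≈⟨ det-equal-at-distance d (swap u q′ (suc q₀)) q′-distance swapped-equal ⟩
    0#                      ≈⟨ -0#≈0# ⟨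
    - 0#                    ∎)
    where
    q′ = inject₁ q₀
    q′-q-adjacent : Adjacent q′ (suc q₀)
    q′-q-adjacent = cong suc (≡.sym (Fin.toℕ-inject₁ q₀))
    q′-distance : toℕ q′ ≡ suc (d ℕ.+ toℕ p)
    q′-distance = ≡.trans (Fin.toℕ-inject₁ q₀) (ℕ.suc-injective distance)
    q′≢q : q′ ≢ suc q₀
    q′≢q q′≡q = ℕ.m≢1+n+m (toℕ q′) {0} (≡.trans (cong toℕ q′≡q) q′-q-adjacent)
    p≢q′ : p ≢ q′
    p≢q′ p≡q′ = ℕ.m≢1+n+m (toℕ p) (≡.trans (cong toℕ p≡q′) q′-distance)
    p≢q : p ≢ suc q₀
    p≢q p≡q = ℕ.m≢1+n+m (toℕ p) {suc d} (≡.trans (cong toℕ p≡q) distance)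
    swapped-equal : swap u q′ (suc q₀) p ≋ swap u q′ (suc q₀) q′
    swapped-equal = ≋-trans (≋-reflexive (cong u (transpose-other p≢q′ p≢q)))
                      (≋-trans up≋uq (≋-reflexive (cong u (≡.sym (transpose-matchˡ q′ (suc q₀))))))

  det-equal : ∀ {n} (u : Mat n) {p q} → p ≢ q → u p ≋ u q → det u ≈ 0#
  det-equal u {p} {q} p≢q up≋uq with ℕ.<-cmp (toℕ p) (toℕ q)
  ... | tri< p<q _ _ = det-equal-at-distance _ u (proj₂ (<⇒distance p<q)) up≋uq
  ... | tri≈ _ p≡q _ = ⊥-elim (p≢q (Fin.toℕ-injective p≡q))
  ... | tri> _ _ q<p = det-equal-at-distance _ u (proj₂ (<⇒distance q<p)) (≋-sym up≋uq)

  det-swap : ∀ {n} (u : Mat n) {p q} → p ≢ q → det (swap u p q) ≈ - det u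
  det-swap u p≢q = det-swap-if-alternating u p≢q (λ w → det-equal w p≢q)

  det-δ : ∀ {n} → det (δ {n}) ≈ 1#
  det-δ {zero}  = refl
  det-δ {suc n} = begin
    det (δ {suc n})   ≈⟨ +-cong (*-identityˡ (det (δ {n}))) (-‿cong (altSum-zero {n} (λ j → zeroˡ (det (minor (suc j) δ))))) ⟩
    det (δ {n}) - 0#  ≈⟨ +-cong (det-δ {n}) -0#≈0# ⟩
    1# + 0#           ≈⟨ +-identityʳ 1# ⟩
    1#                ∎

  -- Selection sort: transpositions only change the sign, and a non-injective
  -- τ repeats a column.
  det-∣-det-∘ : ∀ {n} (v : Mat n) (τ : Fin n → Fin n) → det v ∣ det (v ∘ τ)
  det-∣-det-∘ {n} v τ = sort n 0 (ℕ.+-identityʳ n) τ (λ _ ())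
    where
    sort : ∀ d m → d ℕ.+ m ≡ n → ∀ τ → (∀ k → toℕ k < m → τ k ≡ k) → det v ∣ det (v ∘ τ)
    sort zero    m m≡n τ fixed =
      ∣ʳ-reflexive (det-cong (λ k → ≋-reflexive (cong v (≡.sym (fixed k (≡.subst (toℕ k <_) (≡.sym m≡n) (Fin.toℕ<n k)))))))
    sort (suc d) m d+m≡n τ fixed = place (Fin.any? (λ q → τ q ≟ p))
      where
      m<n : m < n
      m<n = ≡.subst (m <_) d+m≡n (ℕ.m<n+m m (s≤s z≤n))
      p : Fin n
      p = fromℕ< m<n
      d+1+m≡n : d ℕ.+ suc m ≡ n
      d+1+m≡n = ≡.trans (ℕ.+-suc d m) d+m≡n

      fixes-more : ∀ {σ} → σ p ≡ p → (∀ k → toℕ k < m → σ k ≡ k) → ∀ k → toℕ k < suc m → σ k ≡ k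
      fixes-more {σ} σp≡p σ-fixed k k<1+m with ℕ.m<1+n⇒m<n∨m≡n k<1+m
      ... | inj₁ k<m = σ-fixed k k<m
      ... | inj₂ k≡m = ≡.subst (λ k → σ k ≡ k) (Fin.toℕ-injective (≡.trans (Fin.toℕ-fromℕ< m<n) (≡.sym k≡m))) σp≡p

      place : Dec (∃ λ q → τ q ≡ p) → det v ∣ det (v ∘ τ)
      place (no missing) with missing⇒collision τ p (λ q τq≡p → missing (q , τq≡p))
      ... | i , j , i≢j , τi≡τj = ∣ʳ-respʳ-≈ (sym (det-equal (v ∘ τ) i≢j (≋-reflexive (cong v τi≡τj)))) (det v ∣0)
      place (yes (q , τq≡p)) with q ≟ p
      ... | yes ≡.refl = sort d (suc m) d+1+m≡n τ (fixes-more {τ} τq≡p fixed)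
      ... | no q≢p     = ∣ʳ-respʳ-≈ (trans (-‿cong (det-swap (v ∘ τ) (q≢p ∘ ≡.sym))) (-‿involutive _))
                           (∣-‿ (sort d (suc m) d+1+m≡n (swap τ p q) (fixes-more {swap τ p q} swapped-p swapped-fixed)))
        where
        swapped-p : swap τ p q p ≡ p
        swapped-p = ≡.trans (cong τ (transpose-matchˡ p q)) τq≡p
        swapped-fixed : ∀ k → toℕ k < m → swap τ p q k ≡ k
        swapped-fixed k k<m = ≡.trans (cong τ (transpose-other k≢p k≢q)) (fixed k k<m)
          where
          k≢p : k ≢ p
          k≢p k≡p = ℕ.<⇒≢ k<m (≡.trans (cong toℕ k≡p) (Fin.toℕ-fromℕ< m<n))
          k≢q : k ≢ q
          k≢q ≡.refl = q≢p (≡.trans (≡.sym (fixed k k<m)) τq≡p)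

  -- Expand the columns of u one at a time by linearity; what remains are
  -- determinants of families v ∘ τ.
  det-∣-combinations : ∀ {n} (v u : Mat n) → (∀ k → ∃ λ a → u k ≋ linComb a v) → det v ∣ det u
  det-∣-combinations {n} v u combination =
    go n ℕ.≤-refl id u (λ k _ → combination k) (λ k n≤k → ⊥-elim (ℕ.<⇒≱ (Fin.toℕ<n k) n≤k))
    where
    go : ∀ m → m ℕ.≤ n → ∀ τ w → (∀ k → toℕ k < m → ∃ λ a → w k ≋ linComb a v) →
         (∀ k → m ℕ.≤ toℕ k → w k ≋ v (τ k)) → det v ∣ det w
    go zero    _   τ w _        basic = ∣ʳ-respʳ-≈ (det-cong (λ k → ≋-sym (basic k z≤n))) (det-∣-det-∘ v τ)
    go (suc m) m<n τ w combined basic =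
      ∣ʳ-respʳ-≈ (sym expand) (∣-sum (λ j → x∣ʳy⇒x∣ʳzy (a j)
        (go m (ℕ.<⇒≤ m<n) (τ [ p ]≔ j) (w [ p ]≔ v j) (combined′ j) (basic′ j))))
      where
      p = fromℕ< m<n
      toℕp≡m : toℕ p ≡ m
      toℕp≡m = Fin.toℕ-fromℕ< m<n
      p-combined : ∃ λ a → w p ≋ linComb a v
      p-combined = combined p (≡.subst (_< suc m) (≡.sym toℕp≡m) (ℕ.n<1+n m))
      a = proj₁ p-combined

      expand : det w ≈ sum (λ j → a j * det (w [ p ]≔ v j))
      expand = trans (det-cong (≋ᴹ-[]≔ (proj₂ p-combined) (λ _ _ → ≋-refl))) (det-[]≔-linComb w p a v)

      combined′ : ∀ j k → toℕ k < m → ∃ λ a → (w [ p ]≔ v j) k ≋ linComb a v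
      combined′ j k k<m with combined k (ℕ.m<n⇒m<1+n k<m)
      ... | b , wk≋ = b , ≋-trans (≋-reflexive (updateAt-minimal k p w k≢p)) wk≋
        where
        k≢p : k ≢ p
        k≢p k≡p = ℕ.<⇒≢ k<m (≡.trans (cong toℕ k≡p) toℕp≡m)

      basic′ : ∀ j k → m ℕ.≤ toℕ k → (w [ p ]≔ v j) k ≋ v ((τ [ p ]≔ j) k)
      basic′ j k m≤k with k ≟ p
      ... | yes ≡.refl = ≋-reflexive (≡.trans (updateAt-updates p w) (cong v (≡.sym (updateAt-updates p τ))))
      ... | no k≢p     = ≋-trans (≋-reflexive (updateAt-minimal k p w k≢p))
                           (≋-trans (basic k m<k) (≋-reflexive (cong v (≡.sym (updateAt-minimal k p τ k≢p)))))
        where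
        m<k : m < toℕ k
        m<k = ℕ.≤∧≢⇒< m≤k (λ m≡k → k≢p (Fin.toℕ-injective (≡.trans (≡.sym m≡k) (≡.sym toℕp≡m))))

  cramer : ∀ {n} (v : Mat n) a → (∀ i → linComb a v i ≈ 0#) → ∀ k → a k * det v ≈ 0#
  cramer v a combination≈0 k = begin
    a k * det v                             ≈⟨ *-congˡ (det-cong (≗⇒≋ᴹ (updateAt-id-local k v ≡.refl))) ⟨
    a k * det (v [ k ]≔ v k)                ≈⟨ sum-single (λ j → a j * det (v [ k ]≔ v j)) k repeated ⟨
    sum (λ j → a j * det (v [ k ]≔ v j))    ≈⟨ det-[]≔-linComb v k a v ⟨
    det (v [ k ]≔ linComb a v)              ≈⟨ det-[]≔-cong v k combination≈0 ⟩
    det (v [ k ]≔ (λ _ → 0#))               ≈⟨ det-[]≔-zero v k ⟩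
    0#                                      ∎
    where
    repeated : ∀ j → j ≢ k → a j * det (v [ k ]≔ v j) ≈ 0#
    repeated j j≢k = trans (*-congˡ (det-equal (v [ k ]≔ v j) (j≢k ∘ ≡.sym)
      (≋-reflexive (≡.trans (updateAt-updates k v) (≡.sym (updateAt-minimal j k v j≢k)))))) (zeroʳ _)

  spanning⇒det∣1 : ∀ {n} (v : Mat n) → Spanning v → det v ∣ 1#
  spanning⇒det∣1 {n} v spanning = ∣ʳ-respʳ-≈ (det-δ {n}) (det-∣-combinations v δ (spanning ∘ δ))

  spanning⇒independent : ∀ {n} (v : Mat n) → Spanning v → Independent v
  spanning⇒independent v spanning a combination≈0 k with spanning⇒det∣1 v spanning
  ... | q , q*det≈1 = begin
    a k                  ≈⟨ *-identityʳ (a k) ⟨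
    a k * 1#             ≈⟨ *-congˡ q*det≈1 ⟨
    a k * (q * det v)    ≈⟨ x∙yz≈y∙xz (a k) q (det v) ⟩
    q * (a k * det v)    ≈⟨ *-congˡ (cramer v a combination≈0 k) ⟩
    q * 0#               ≈⟨ zeroʳ q ⟩
    0#                   ∎

  -- Coordinates and change of basis

  sum-‿ : ∀ {n} (f : Vector Carrier n) → sum (λ i → - f i) ≈ - sum f
  sum-‿ {zero}  f = sym -0#≈0#
  sum-‿ {suc n} f = trans (+-congˡ (sum-‿ (f ∘ suc))) (-‿+-comm _ _)

  linComb-cong : ∀ {m n} {a b : Vector Carrier m} {u w : Vector (Vector Carrier n) m} →
                 a ≋ b → (∀ i → u i ≋ w i) → linComb a u ≋ linComb b w
  linComb-cong a≋b u≋w j = sum-cong-≋ (λ i → *-cong (a≋b i) (u≋w i j))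

  linComb-δ : ∀ {m n} (v : Vector (Vector Carrier n) m) i → linComb (δ i) v ≋ v i
  linComb-δ v i j = ∑-δ i (λ k → v k j)

  linComb-standard : ∀ {n} (x : Vector Carrier n) → x ≋ linComb x δ
  linComb-standard x j = begin
    x j                       ≈⟨ ∑-δ j x ⟨
    sum (λ i → δ j i * x i)   ≈⟨ sum-cong-≋ (λ i → trans (*-comm _ _) (*-congˡ (reflexive (δ-sym j i)))) ⟩
    linComb x δ j             ∎

  linComb-linComb : ∀ {l m n} (a : Vector Carrier l) (b : Vector (Vector Carrier m) l) (v : Vector (Vector Carrier n) m) →
                    linComb a (λ i → linComb (b i) v) ≋ linComb (linComb a b) v
  linComb-linComb a b v j = begin
    sum (λ i → a i * sum (λ k → b i k * v k j))   ≈⟨ sum-cong-≋ (λ i → *-distribˡ-sum (a i) (λ k → b i k * v k j)) ⟩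
    sum (λ i → sum (λ k → a i * (b i k * v k j))) ≈⟨ ∑-comm (λ i k → a i * (b i k * v k j)) ⟩
    sum (λ k → sum (λ i → a i * (b i k * v k j))) ≈⟨ sum-cong-≋ (λ k → sum-cong-≋ (λ i → *-assoc (a i) (b i k) (v k j))) ⟨
    sum (λ k → sum (λ i → a i * b i k * v k j))   ≈⟨ sum-cong-≋ (λ k → *-distribʳ-sum (v k j) (λ i → a i * b i k)) ⟨
    sum (λ k → linComb a b k * v k j)             ∎

  linComb-injective : ∀ {m n} (v : Vector (Vector Carrier n) m) → Independent v →
                      ∀ {a b} → linComb a v ≋ linComb b v → a ≋ b
  linComb-injective v independent {a} {b} a≡b = x∙y⁻¹≈ε⇒x≈y _ _ ∘ independent (λ i → a i - b i) difference≈0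
    where
    difference≈0 : ∀ j → linComb (λ i → a i - b i) v j ≈ 0#
    difference≈0 j = begin
      sum (λ i → (a i - b i) * v i j)                 ≈⟨ sum-cong-≋ (λ i → [y-z]x≈yx-zx (v i j) (a i) (b i)) ⟩
      sum (λ i → a i * v i j - b i * v i j)           ≈⟨ ∑-distrib-+ (λ i → a i * v i j) (λ i → - (b i * v i j)) ⟩
      linComb a v j + sum (λ i → - (b i * v i j))     ≈⟨ +-congˡ (sum-‿ (λ i → b i * v i j)) ⟩
      linComb a v j - linComb b v j                   ≈⟨ x≈y⇒x∙y⁻¹≈ε (a≡b j) ⟩
      0#                                              ∎

  pair-coefficients-unique : ∀ {m n} (v : Vector (Vector Carrier n) m) → Independent v → ∀ {i j} → i ≢ j →
    ∀ {x y x′ y′} → (∀ t → x * v i t + y * v j t ≈ x′ * v i t + y′ * v j t) → x ≈ x′ × y ≈ y′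
  pair-coefficients-unique {m} v independent {i} {j} i≢j {x} {y} {x′} {y′} same-vector =
    trans (sym (pair-at-i x y)) (trans (same-pair i) (pair-at-i x′ y′)) ,
    trans (sym (pair-at-j x y)) (trans (same-pair j) (pair-at-j x′ y′))
    where
    pair : Carrier → Carrier → Vector Carrier m
    pair a b k = a * δ i k + b * δ j k

    linComb-pair : ∀ a b t → linComb (pair a b) v t ≈ a * v i t + b * v j t
    linComb-pair a b t = begin
      sum (λ k → (a * δ i k + b * δ j k) * v k t)
        ≈⟨ sum-cong-≋ (λ k → distributes a b (δ i k) (δ j k) (v k t)) ⟩
      sum (λ k → a * (δ i k * v k t) + b * (δ j k * v k t))
        ≈⟨ ∑-distrib-+ (λ k → a * (δ i k * v k t)) (λ k → b * (δ j k * v k t)) ⟩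
      sum (λ k → a * (δ i k * v k t)) + sum (λ k → b * (δ j k * v k t))
        ≈⟨ +-cong (*-distribˡ-sum a (λ k → δ i k * v k t)) (*-distribˡ-sum b (λ k → δ j k * v k t)) ⟨
      a * sum (λ k → δ i k * v k t) + b * sum (λ k → δ j k * v k t)
        ≈⟨ +-cong (*-congˡ (∑-δ i (λ k → v k t))) (*-congˡ (∑-δ j (λ k → v k t))) ⟩
      a * v i t + b * v j t ∎
      where
      distributes : ∀ a b x y z → (a * x + b * y) * z ≈ a * (x * z) + b * (y * z)
      distributes = solve 5 (λ a b x y z → (a :* x :+ b :* y) :* z := a :* (x :* z) :+ b :* (y :* z)) refl

    same-pair : pair x y ≋ pair x′ y′
    same-pair = linComb-injective v independent (λ t → trans (linComb-pair x y t) (trans (same-vector t) (sym (linComb-pair x′ y′ t))))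

    pair-at-i : ∀ a b → pair a b i ≈ a
    pair-at-i a b = begin
      a * δ i i + b * δ j i   ≈⟨ +-cong (*-congˡ (reflexive (δ-diagonal i))) (*-congˡ (reflexive (δ-off-diagonal (i≢j ∘ ≡.sym)))) ⟩
      a * 1# + b * 0#         ≈⟨ +-cong (*-identityʳ a) (zeroʳ b) ⟩
      a + 0#                  ≈⟨ +-identityʳ a ⟩
      a                       ∎

    pair-at-j : ∀ a b → pair a b j ≈ b
    pair-at-j a b = begin
      a * δ i j + b * δ j j   ≈⟨ +-cong (*-congˡ (reflexive (δ-off-diagonal i≢j))) (*-congˡ (reflexive (δ-diagonal j))) ⟩
      a * 0# + b * 1#         ≈⟨ +-cong (zeroʳ a) (*-identityʳ b) ⟩
      0# + b                  ≈⟨ +-identityˡ b ⟩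
      b                       ∎

  spanning-scale : ∀ {m n} (v : Vector (Vector Carrier n) m) (μ μ⁻¹ : Vector Carrier m) →
                   (∀ i → μ⁻¹ i * μ i ≈ 1#) → Spanning v → Spanning (λ i t → μ i * v i t)
  spanning-scale v μ μ⁻¹ inverses spanning x with spanning x
  ... | a , x≋ = (λ i → a i * μ⁻¹ i) , λ t → trans (x≋ t) (sum-cong-≋ (λ i → rescale i t))
    where
    rescale : ∀ i t → a i * v i t ≈ a i * μ⁻¹ i * (μ i * v i t)
    rescale i t = begin
      a i * v i t                    ≈⟨ *-congˡ (*-identityˡ (v i t)) ⟨
      a i * (1# * v i t)             ≈⟨ *-congˡ (*-congʳ (inverses i)) ⟨
      a i * (μ⁻¹ i * μ i * v i t)    ≈⟨ regroup (a i) (μ⁻¹ i) (μ i) (v i t) ⟩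
      a i * μ⁻¹ i * (μ i * v i t)    ∎
      where
      regroup : ∀ a q μ w → a * (q * μ * w) ≈ a * q * (μ * w)
      regroup = solve 4 (λ a q μ w → a :* (q :* μ :* w) := a :* q :* (μ :* w)) refl

  infixr 7 _·_

  _·_ : ∀ {n} → Mat n → Vector Carrier n → Vector Carrier n
  (g · x) i = sum (λ j → g i j * x j)

  ·-cong : ∀ {n} (g : Mat n) {x y} → x ≋ y → g · x ≋ g · y
  ·-cong g x≋y i = sum-cong-≋ (λ j → *-congˡ (x≋y j))

  ·-linear : ∀ {n} (g : Mat n) a x y → g · (λ j → x j + a * y j) ≋ (λ i → (g · x) i + a * (g · y) i)
  ·-linear g a x y i = begin
    sum (λ j → g i j * (x j + a * y j))                   ≈⟨ sum-cong-≋ (λ j → distributes (g i j) a (x j) (y j)) ⟩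
    sum (λ j → g i j * x j + a * (g i j * y j))           ≈⟨ ∑-distrib-+ (λ j → g i j * x j) (λ j → a * (g i j * y j)) ⟩
    (g · x) i + sum (λ j → a * (g i j * y j))             ≈⟨ +-congˡ (*-distribˡ-sum a (λ j → g i j * y j)) ⟨
    (g · x) i + a * (g · y) i                             ∎
    where
    distributes : ∀ g a x y → g * (x + a * y) ≈ g * x + a * (g * y)
    distributes = solve 4 (λ g a x y → g :* (x :+ a :* y) := g :* x :+ a :* (g :* y)) refl

  ·-scale : ∀ {n} (g : Mat n) a x → g · (λ j → a * x j) ≋ (λ i → a * (g · x) i)
  ·-scale g a x i = trans (sum-cong-≋ (λ j → x∙yz≈y∙xz (g i j) a (x j))) (sym (*-distribˡ-sum a (λ j → g i j * x j)))

  linCombMatrix : ∀ {n} → Mat n → Mat n → Mat n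
  linCombMatrix C w i j = linComb (λ k → C k j) w i

  linCombMatrix-· : ∀ {n} (C w : Mat n) x → linCombMatrix C w · x ≋ linComb (C · x) w
  linCombMatrix-· C w x i = begin
    sum (λ j → sum (λ k → C k j * w k i) * x j)     ≈⟨ sum-cong-≋ (λ j → *-distribʳ-sum (x j) (λ k → C k j * w k i)) ⟩
    sum (λ j → sum (λ k → C k j * w k i * x j))     ≈⟨ ∑-comm (λ j k → C k j * w k i * x j) ⟩
    sum (λ k → sum (λ j → C k j * w k i * x j))     ≈⟨ sum-cong-≋ (λ k → sum-cong-≋ (λ j → xy∙z≈xz∙y (C k j) (w k i) (x j))) ⟩
    sum (λ k → sum (λ j → C k j * x j * w k i))     ≈⟨ sum-cong-≋ (λ k → *-distribʳ-sum (w k i) (λ j → C k j * x j)) ⟨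
    sum (λ k → (C · x) k * w k i)                   ∎

  module Coordinates {n} (v : Mat n) (spanning : Spanning v) where

    C : Mat n
    C k j = proj₁ (spanning (δ j)) k

    linComb-coordinates : ∀ x → x ≋ linComb (C · x) v
    linComb-coordinates x j = begin
      x j                                             ≈⟨ linComb-standard x j ⟩
      linComb x δ j                                   ≈⟨ linComb-cong ≋-refl (λ i → proj₂ (spanning (δ i))) j ⟩
      linComb x (λ i → linComb (λ k → C k i) v) j     ≈⟨ linComb-linComb x (λ i k → C k i) v j ⟩
      linComb (λ k → sum (λ i → x i * C k i)) v j     ≈⟨ linComb-cong (λ k → sum-cong-≋ (λ i → *-comm (x i) (C k i))) (λ i → ≋-refl {x = v i}) j ⟩
      linComb (C · x) v j                             ∎

    coordinates-linComb : ∀ a → C · linComb a v ≋ a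
    coordinates-linComb a = linComb-injective v (spanning⇒independent v spanning) (≋-sym (linComb-coordinates (linComb a v)))

  basisMap : ∀ {n} (v : Mat n) → Spanning v → Mat n → Mat n
  basisMap v spanning = linCombMatrix (Coordinates.C v spanning)

  basisMap-basis : ∀ {n} (v : Mat n) (spanning : Spanning v) w i → basisMap v spanning w · v i ≋ w i
  basisMap-basis v spanning w i =
    ≋-trans (linCombMatrix-· C w (v i))
      (≋-trans (linComb-cong coordinates-vᵢ (λ _ → ≋-refl)) (linComb-δ w i))
    where
    open Coordinates v spanning
    coordinates-vᵢ : C · v i ≋ δ i
    coordinates-vᵢ = ≋-trans (·-cong C (≋-sym (linComb-δ v i))) (coordinates-linComb (δ i))

  basisMap-inverse : ∀ {n} (v w : Mat n) (v-spanning : Spanning v) (w-spanning : Spanning w) x →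
                     basisMap w w-spanning v · basisMap v v-spanning w · x ≋ x
  basisMap-inverse v w v-spanning w-spanning x =
    ≋-trans (linCombMatrix-· W.C v _)
      (≋-trans (linComb-cong (≋-trans (·-cong W.C (linCombMatrix-· V.C w x)) (W.coordinates-linComb (V.C · x)))
                             (λ _ → ≋-refl))
               (≋-sym (V.linComb-coordinates x)))
    where
    module V = Coordinates v v-spanning
    module W = Coordinates w w-spanning

module FieldProperties {c ℓ} (F : Field c ℓ) where

  open Field F hiding (zero)
  open import Algebra.Properties.CommutativeMonoid.Sum *-commutativeMonoid using () renaming (sum to ∏)
  open import Algebra.Properties.Semiring.Divisibility semiring using (_∣_; _,_; x∣y∧y≉0⇒x≉0; ∣ʳ-respʳ-≈)
  open import Algebra.Properties.CommutativeSemigroup.Divisibility *-commutativeSemigroup using (∙-cong-∣)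
  open import Relation.Binary.Reasoning.Setoid setoid

  ≉0⇒∣1 : ∀ {x} → x ≉ 0# → x ∣ 1#
  ≉0⇒∣1 {x} x≉0 with inverse x x≉0
  ... | y , xy≈1 = y , trans (*-comm y x) xy≈1

  ∣1⇒≉0 : ∀ {x} → x ∣ 1# → x ≉ 0#
  ∣1⇒≉0 x∣1 = x∣y∧y≉0⇒x≉0 x∣1 1≉0

  *-≉0 : ∀ {x y} → x ≉ 0# → y ≉ 0# → x * y ≉ 0#
  *-≉0 x≉0 y≉0 = ∣1⇒≉0 (∣ʳ-respʳ-≈ (*-identityˡ 1#) (∙-cong-∣ (≉0⇒∣1 x≉0) (≉0⇒∣1 y≉0)))

  ∏-≉0 : ∀ {m} (f : Vector Carrier m) → (∀ i → f i ≉ 0#) → ∏ f ≉ 0#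
  ∏-≉0 {zero}  f _    = 1≉0
  ∏-≉0 {suc m} f f≉0 = *-≉0 (f≉0 zero) (∏-≉0 (f ∘ suc) (f≉0 ∘ suc))

  *-cancelˡ : ∀ {x y z} → x ≉ 0# → x * y ≈ x * z → y ≈ z
  *-cancelˡ {x} {y} {z} x≉0 xy≈xz with ≉0⇒∣1 x≉0
  ... | q , qx≈1 = begin
    y              ≈⟨ *-identityˡ y ⟨
    1# * y         ≈⟨ *-congʳ qx≈1 ⟨
    q * x * y      ≈⟨ *-assoc q x y ⟩
    q * (x * y)    ≈⟨ *-congˡ xy≈xz ⟩
    q * (x * z)    ≈⟨ *-assoc q x z ⟨
    q * x * z      ≈⟨ *-congʳ qx≈1 ⟩
    1# * z         ≈⟨ *-identityˡ z ⟩
    z              ∎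

module Points {c ℓ} (F : Field c ℓ) (n : ℕ) where

  open Field F hiding (zero)
  open FieldProperties F
  open LinearAlgebra commutativeRing using (_·_; ·-cong; ·-scale)
  open import Algebra.Properties.Semiring.Divisibility semiring using (_,_)
  open import Algebra.Solver.Ring.NaturalCoefficients.Default commutativeSemiring using (solve; _:=_; _:+_; _:*_)
  open import Data.Vec.Functional.Relation.Binary.Equality.Setoid setoid using (_≋_)
  open import Relation.Binary.Reasoning.Setoid setoid

  infix 4 _∼_

  _∼_ : Vec F n → Vec F n → Set (c ⊔ ℓ)
  _∼_ = SamePoint F n

  ≋⇒∼ : ∀ {u v} → u ≋ v → u ∼ v
  ≋⇒∼ u≋v = 1# , 1≉0 , λ j → trans (u≋v j) (sym (*-identityˡ _))

  ∼-sym : ∀ {u v} → u ∼ v → v ∼ u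
  ∼-sym {u} {v} (t , t≉0 , u≈tv) with ≉0⇒∣1 t≉0
  ... | s , st≈1 = s , ∣1⇒≉0 (t , trans (*-comm t s) st≈1) , λ j → begin
    v j            ≈⟨ *-identityˡ (v j) ⟨
    1# * v j       ≈⟨ *-congʳ st≈1 ⟨
    s * t * v j    ≈⟨ *-assoc s t (v j) ⟩
    s * (t * v j)  ≈⟨ *-congˡ (u≈tv j) ⟨
    s * u j        ∎

  ∼-trans : ∀ {u v w} → u ∼ v → v ∼ w → u ∼ w
  ∼-trans {u} {v} {w} (t , t≉0 , u≈tv) (s , s≉0 , v≈sw) =
    t * s , *-≉0 t≉0 s≉0 , λ j → trans (u≈tv j) (trans (*-congˡ (v≈sw j)) (sym (*-assoc t s (w j))))

  ∼-· : ∀ (g : Matrix F n) {u v} → u ∼ v → g · u ∼ g · v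
  ∼-· g {u} {v} (t , t≉0 , u≈tv) = t , t≉0 , λ i → trans (·-cong g u≈tv i) (·-scale g t v i)

  ∼-line : ∀ {p q : Vec F n} → (∀ {x y x′ y′} → (∀ j → x * p j + y * q j ≈ x′ * p j + y′ * q j) → x ≈ x′ × y ≈ y′) →
           ∀ {x y d} → x ≉ 0# → ((λ j → x * p j + y * q j) ∼ (λ j → p j + d * q j)) ⇔ (y ≈ x * d)
  ∼-line {p} {q} unique {x} {y} {d} x≉0 = mk⇔ to from
    where
    expand : ∀ t j → t * (p j + d * q j) ≈ t * p j + t * d * q j
    expand t j = solve 4 (λ t P d Q → t :* (P :+ d :* Q) := t :* P :+ t :* d :* Q) refl t (p j) d (q j)

    to : (λ j → x * p j + y * q j) ∼ (λ j → p j + d * q j) → y ≈ x * d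
    to (t , _ , same) with unique (λ j → trans (same j) (expand t j))
    ... | x≈t , y≈td = trans y≈td (*-congʳ (sym x≈t))

    from : y ≈ x * d → (λ j → x * p j + y * q j) ∼ (λ j → p j + d * q j)
    from y≈xd = x , x≉0 , λ j → trans (+-congˡ (*-congʳ y≈xd)) (sym (expand x j))

module ProjectiveConfigurations {c ℓ} (F : Field c ℓ) (k : ℕ) where

  open Field F hiding (zero)
  open FieldProperties F
  open LinearAlgebra commutativeRing
  open CyclicProducts *-commutativeMonoid using (∏-telescope; gauge; gauge-twists)
  open import Algebra.Properties.CommutativeMonoid.Sum *-commutativeMonoid using (sum-replicate-zero) renaming (sum to ∏)
  open import Algebra.Solver.Ring.NaturalCoefficients.Default commutativeSemiring using (solve; _:=_; _:+_; _:*_)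
  open import Data.Vec.Functional.Relation.Binary.Equality.Setoid setoid using (_≋_; ≋-refl)
  open import Relation.Binary.Reasoning.Setoid setoid

  n : ℕ
  n = suc (suc k)

  open Points F n

  -- cs i is the coefficient of φ_i in the bases l i, l (next i).
  PhiCoefficients : SpecialConfig F n → Vector Carrier n → Set (c ⊔ ℓ)
  PhiCoefficients C cs = ∀ i → m i ∼ (λ j → l i j + cs i * l (next i) j)
    where open SpecialConfig C

  phiCoefficients-exist : ∀ (C : SpecialConfig F n) → ∃ (PhiCoefficients C)
  phiCoefficients-exist C = (λ i → coefficient (on-line i)) , λ i → represents (on-line i)
    where
    open SpecialConfig C
    a≉0 : ∀ {i} ((a , b , _) : OnLine F n (m i) (l i) (l (next i))) → a ≉ 0#
    a≉0 {i} (a , b , m≈) a≈0 = m≢lᵢ₊₁ i (b , b≉0 , m≈bl′)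
      where
      m≈bl′ : ∀ j → m i j ≈ b * l (next i) j
      m≈bl′ j = trans (m≈ j) (trans (+-congʳ (trans (*-congʳ a≈0) (zeroˡ _))) (+-identityˡ _))
      b≉0 : b ≉ 0#
      b≉0 b≈0 = m-nz i (λ j → trans (m≈bl′ j) (trans (*-congʳ b≈0) (zeroˡ _)))
    coefficient : ∀ {i} → OnLine F n (m i) (l i) (l (next i)) → Carrier
    coefficient online@(a , b , _) = b * proj₁ (inverse a (a≉0 online))
    represents : ∀ {i} (online : OnLine F n (m i) (l i) (l (next i))) → m i ∼ (λ j → l i j + coefficient online * l (next i) j)
    represents {i} online@(a , b , m≈) with inverse a (a≉0 online)
    ... | q , aq≈1 = a , a≉0 online , λ j → begin
      m i j                                     ≈⟨ m≈ j ⟩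
      a * l i j + b * l (next i) j              ≈⟨ +-congˡ (*-congʳ (trans (*-congˡ aq≈1) (*-identityʳ b))) ⟨
      a * l i j + b * (a * q) * l (next i) j    ≈⟨ regroup a b q (l i j) (l (next i) j) ⟩
      a * (l i j + b * q * l (next i) j)        ∎
      where
      regroup : ∀ a b q L L′ → a * L + b * (a * q) * L′ ≈ a * (L + b * q * L′)
      regroup = solve 5 (λ a b q L L′ → a :* L :+ b :* (a :* q) :* L′ := a :* (L :+ b :* q :* L′)) refl

  phiCoefficient≉0 : ∀ (C : SpecialConfig F n) {cs} → PhiCoefficients C cs → ∀ i → cs i ≉ 0#
  phiCoefficient≉0 C {cs} phi i cs≈0 = m≢lᵢ i (∼-trans (phi i) (≋⇒∼ collapse))
    where
    open SpecialConfig C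
    collapse : (λ j → l i j + cs i * l (next i) j) ≋ l i
    collapse j = trans (+-congˡ (trans (*-congʳ cs≈0) (zeroˡ _))) (+-identityʳ _)

  adjacent-coefficients-unique : ∀ (C : SpecialConfig F n) i → let open SpecialConfig C in
    ∀ {x y x′ y′} → (∀ j → x * l i j + y * l (next i) j ≈ x′ * l i j + y′ * l (next i) j) → x ≈ x′ × y ≈ y′
  adjacent-coefficients-unique C i =
    pair-coefficients-unique l (spanning⇒independent l simplex) (next≢id {k} i ∘ ≡.sym)
    where open SpecialConfig C

  -- Both g (m i) and the m i of D lie on the line through l i and l (next i)
  -- of D, where coordinates are unique.
  transport : ∀ (C D : SpecialConfig F n) (g : Matrix F n) (μ : Vector Carrier n) → (∀ i → μ i ≉ 0#) →
              (∀ i → g · SpecialConfig.l C i ≋ (λ j → μ i * SpecialConfig.l D i j)) →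
              ∀ {cs ds} → PhiCoefficients C cs → PhiCoefficients D ds →
              ∀ i → (g · SpecialConfig.m C i ∼ SpecialConfig.m D i) ⇔ (cs i * μ (next i) ≈ μ i * ds i)
  transport C D g μ μ≉0 maps-l {cs} {ds} C-phi D-phi i = mk⇔
    (λ g-m∼m′ → Equivalence.to line (∼-trans (∼-sym image) (∼-trans g-m∼m′ (D-phi i))))
    (λ related → ∼-trans image (∼-trans (Equivalence.from line related) (∼-sym (D-phi i))))
    where
    module C = SpecialConfig C
    module D = SpecialConfig D
    line : ((λ j → μ i * D.l i j + cs i * μ (next i) * D.l (next i) j) ∼ (λ j → D.l i j + ds i * D.l (next i) j))
           ⇔ (cs i * μ (next i) ≈ μ i * ds i)
    line = ∼-line {D.l i} {D.l (next i)} (adjacent-coefficients-unique D i) (μ≉0 i)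

    image : g · C.m i ∼ (λ j → μ i * D.l i j + cs i * μ (next i) * D.l (next i) j)
    image = ∼-trans (∼-· g (C-phi i)) (≋⇒∼ λ j → begin
      (g · (λ t → C.l i t + cs i * C.l (next i) t)) j
        ≈⟨ ·-linear g (cs i) (C.l i) (C.l (next i)) j ⟩
      (g · C.l i) j + cs i * (g · C.l (next i)) j
        ≈⟨ +-cong (maps-l i j) (*-congˡ (maps-l (next i) j)) ⟩
      μ i * D.l i j + cs i * (μ (next i) * D.l (next i) j)
        ≈⟨ +-congˡ (*-assoc (cs i) (μ (next i)) _) ⟨
      μ i * D.l i j + cs i * μ (next i) * D.l (next i) j ∎)

  crossRatio-exists : ∀ (C : SpecialConfig F n) → ∃ λ r → IsCrossRatio F n C r
  crossRatio-exists C = ∏ cs , cs , phi , refl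
    where
    cs = proj₁ (phiCoefficients-exist C)
    phi = proj₂ (phiCoefficients-exist C)

  crossRatio≉0 : ∀ (C : SpecialConfig F n) r → IsCrossRatio F n C r → r ≉ 0#
  crossRatio≉0 C r (cs , phi , r≈∏cs) r≈0 = ∏-≉0 cs (phiCoefficient≉0 C phi) (trans (sym r≈∏cs) r≈0)

  crossRatio-invariant : ∀ (C D : SpecialConfig F n) r s → PGLEquiv F n C D → IsCrossRatio F n C r → IsCrossRatio F n D s → r ≈ s
  crossRatio-invariant C D r s (g , _ , maps-l , maps-m) (cs , C-phi , r≈∏cs) (ds , D-phi , s≈∏ds) = begin
    r     ≈⟨ r≈∏cs ⟩
    ∏ cs  ≈⟨ *-cancelˡ (∏-≉0 μ μ≉0) (∏-telescope cs ds μ related) ⟩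
    ∏ ds  ≈⟨ s≈∏ds ⟨
    s     ∎
    where
    μ = λ i → proj₁ (maps-l i)
    μ≉0 = λ i → proj₁ (proj₂ (maps-l i))
    related : ∀ i → cs i * μ (next i) ≈ μ i * ds i
    related i = Equivalence.to (transport C D g μ μ≉0 (λ i → proj₂ (proj₂ (maps-l i))) C-phi D-phi i) (maps-m i)

  crossRatio-injective : ∀ (C D : SpecialConfig F n) r s → IsCrossRatio F n C r → IsCrossRatio F n D s → r ≈ s → PGLEquiv F n C D
  crossRatio-injective C D r s (cs , C-phi , r≈∏cs) (ds , D-phi , s≈∏ds) r≈s =
    g , (h , basisMap-inverse C.l D′ C.simplex D′-spanning , basisMap-inverse D′ C.l D′-spanning C.simplex) ,
    (λ i → μ i , μ≉0 i , maps-l i) ,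
    (λ i → Equivalence.from (transport C D g μ μ≉0 maps-l C-phi D-phi i) (gauge-twists cs ds ∏cs≈∏ds i))
    where
    module C = SpecialConfig C
    module D = SpecialConfig D
    ∏cs≈∏ds : ∏ cs ≈ ∏ ds
    ∏cs≈∏ds = trans (sym r≈∏cs) (trans r≈s s≈∏ds)
    μ = gauge cs ds
    μ≉0 : ∀ i → μ i ≉ 0#
    μ≉0 i = ∏-≉0 _ (splice-preserves (_≉ 0#) (phiCoefficient≉0 D D-phi) (phiCoefficient≉0 C C-phi) (Fin.toℕ i))
    D′ : Vector (Vec F n) n
    D′ i j = μ i * D.l i j
    D′-spanning : Spanning D′
    D′-spanning = spanning-scale D.l μ (λ i → proj₁ (inverse (μ i) (μ≉0 i)))
                    (λ i → trans (*-comm _ _) (proj₂ (inverse (μ i) (μ≉0 i)))) D.simplex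
    g h : Matrix F n
    g = basisMap C.l C.simplex D′
    h = basisMap D′ D′-spanning C.l
    maps-l : ∀ i → g · C.l i ≋ D′ i
    maps-l = basisMap-basis C.l C.simplex D′

  standard-configuration : ∀ r → r ≉ 0# → ∃ λ C → IsCrossRatio F n C r
  standard-configuration r r≉0 = C , cs , (λ i → ≋⇒∼ ≋-refl) , ∏cs≈r
    where
    cs : Vector Carrier n
    cs = r ∷ λ _ → 1#
    cs≉0 : ∀ i → cs i ≉ 0#
    cs≉0 zero    = r≉0
    cs≉0 (suc _) = 1≉0
    ∏cs≈r : r ≈ ∏ cs
    ∏cs≈r = sym (trans (*-congˡ (sum-replicate-zero (suc k))) (*-identityʳ r))
    m : Vector (Vec F n) n
    m i j = δ i j + cs i * δ (next i) j
    δ-on : ∀ i → δ {n} i i ≈ 1#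
    δ-on i = reflexive (δ-diagonal i)
    next-off : ∀ i → δ i (next i) ≈ 0#
    next-off i = reflexive (δ-off-diagonal (next≢id i ∘ ≡.sym))
    back-off : ∀ i → δ (next i) i ≈ 0#
    back-off i = reflexive (δ-off-diagonal (next≢id i))
    m-at-i : ∀ i → m i i ≈ 1#
    m-at-i i = trans (+-cong (δ-on i) (trans (*-congˡ (back-off i)) (zeroʳ _))) (+-identityʳ 1#)
    m-at-next : ∀ i → m i (next i) ≈ cs i
    m-at-next i = trans (+-cong (next-off i) (trans (*-congˡ (δ-on (next i))) (*-identityʳ _))) (+-identityˡ _)
    C : SpecialConfig F n
    C = record
      { l       = δ
      ; m       = m
      ; l-nz    = λ i δᵢ≈0 → 1≉0 (trans (sym (δ-on i)) (δᵢ≈0 i))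
      ; m-nz    = λ i mᵢ≈0 → 1≉0 (trans (sym (m-at-i i)) (mᵢ≈0 i))
      ; simplex = λ x → x , linComb-standard x
      ; on-line = λ i → 1# , cs i , λ j → +-congʳ (sym (*-identityˡ _))
      ; m≢lᵢ    = λ { i (t , _ , m≈tδ) →
                    cs≉0 i (trans (sym (m-at-next i)) (trans (m≈tδ (next i)) (trans (*-congˡ (next-off i)) (zeroʳ t)))) }
      ; m≢lᵢ₊₁  = λ { i (t , _ , m≈tδ) →
                    1≉0 (trans (sym (m-at-i i)) (trans (m≈tδ i) (trans (*-congˡ (back-off i)) (zeroʳ t)))) }
      }

proposition3p9 : ∀ {c ℓ} (F : Field c ℓ) (n : ℕ) → 2 ≤ n →
    let open Field F in
      -- every special configuration has a generalized cross-ratio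
      (∀ (C : SpecialConfig F n) → ∃ λ r → IsCrossRatio F n C r)
      -- which lies in F^*
      × (∀ (C : SpecialConfig F n) r → IsCrossRatio F n C r → ¬ (r ≈ 0#))
      -- and is constant on PGL_n(F)-orbits (well-defined on the quotient)
      × (∀ (C D : SpecialConfig F n) r s → PGLEquiv F n C D →
           IsCrossRatio F n C r → IsCrossRatio F n D s → r ≈ s)
      -- injective on orbits
      × (∀ (C D : SpecialConfig F n) r s → IsCrossRatio F n C r →
           IsCrossRatio F n D s → r ≈ s → PGLEquiv F n C D)
      -- surjective onto F^*
      × (∀ r → ¬ (r ≈ 0#) → ∃ λ (C : SpecialConfig F n) → IsCrossRatio F n C r)
proposition3p9 F (suc (suc k)) (s≤s (s≤s z≤n)) =
  crossRatio-exists , crossRatio≉0 , crossRatio-invariant , crossRatio-injective , standard-configuration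
  where open ProjectiveConfigurations F k
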